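{- Let $r_1\ge 2$ and $x_1\ge 1$ be integers, set $d=x_1+r_1-1$, and let $\mathbf{q}=(r_1^{x_1},(1+r_1x_1)^{r_1-1})\in\mathbb{Z}^d$, i.e. the first $x_1$ entries equal $r_1$ and the remaining $r_1-1$ entries equal $1+r_1x_1$. Let $\Delta_{(1,\mathbf{q})}=\operatorname{conv}\{\mathbf{e}_1,\ldots,\mathbf{e}_d,-\mathbf{q}\}\subset\mathbb{R}^d$ (this simplex has the integer decomposition property). Define $\mathbf{a}'_{r_1+1}=((-1)^{x_1},(-x_1)^{r_1-1})$, $\mathbf{a}'_{r_1+2}=(0^{x_1},(-1)^{r_1-1})$, $\mathbf{a}'_{r_1+3}=\mathbf{0}$, $\mathbf{a}'_i=(r_1-i+1)\mathbf{a}'_{r_1+1}+\mathbf{a}'_{r_1+2}$ for $1\le i\le r_1$, and $\mathbf{b}'_j=\mathbf{e}_{d-j+1}$ for $1\le j\le d$, and let $\mathcal{A}'=\{\mathbf{a}'_1,\ldots,\mathbf{a}'_{r_1+3},\mathbf{b}'_1,\ldots,\mathbf{b}'_d\}$. Then $\Delta_{(1,\mathbf{q})}\cap\mathbb{Z}^d=\mathcal{A}'$.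
   Context: $\mathbf{e}_i$ denotes the $i$-th standard basis vector of $\mathbb{R}^d$. The notation $(r^{x},s^{y})$ denotes the vector consisting of $x$ copies of $r$ followed by $y$ copies of $s$. A lattice polytope $P\subset\mathbb{R}^d$ has the integer decomposition property if for every integer $M\ge1$ each lattice point of $MP$ is a sum of $M$ lattice points of $P$. -}

module Defs where

open import Data.Nat as ℕ using (ℕ; zero; suc; _∸_; _<ᵇ_)
open import Data.Integer as ℤ using (ℤ; +_; -_)
open import Data.Rational as ℚ using (ℚ; 0ℚ; 1ℚ; _≤_; _+_; _*_)
open import Data.Fin using (Fin; toℕ; opposite)
open import Data.Fin.Properties using (_≟_)
open import Data.Bool using (if_then_else_)
open import Data.List using (List; upTo; map; _++_)
open import Data.List.Relation.Unary.Any using (Any)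
open import Data.Product using (Σ; _×_)
open import Relation.Binary.PropositionalEquality using (_≡_)
open import Relation.Nullary using (does)

-- integer vectors in ℤ^d, as functions on coordinates (0-based)
IVec : ℕ → Set
IVec d = Fin d → ℤ

sumFin : ∀ {n} → (Fin n → ℚ) → ℚ
sumFin {zero}  f = 0ℚ
sumFin {suc n} f = f Data.Fin.zero + sumFin (λ i → f (Data.Fin.suc i))

-- standard basis vector e_(i+1) (0-based index i)
e : ∀ {d} → Fin d → IVec d
e i k = if does (i ≟ k) then + 1 else + 0

InConv : ∀ {d n} → (Fin n → IVec d) → IVec d → Set
InConv {d} {n} vs z =
  Σ (Fin n → ℚ) λ λs →
    (∀ i → 0ℚ ≤ λs i) ×
    (sumFin λs ≡ 1ℚ) ×
    (∀ k → ℚ._/_ (z k) 1 ≡ sumFin (λ i → λs i * ℚ._/_ (vs i k) 1))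

dim : ℕ → ℕ → ℕ
dim r x = x ℕ.+ (r ∸ 1)

qvec : (r x : ℕ) → IVec (dim r x)
qvec r x k = if toℕ k <ᵇ x then + r else + (1 ℕ.+ r ℕ.* x)

simplexVerts : (r x : ℕ) → Fin (suc (dim r x)) → IVec (dim r x)
simplexVerts r x Data.Fin.zero    k = - qvec r x k
simplexVerts r x (Data.Fin.suc i) k = e i k

aR1 : (r x : ℕ) → IVec (dim r x)
aR1 r x k = if toℕ k <ᵇ x then - (+ 1) else - (+ x)

aR2 : (r x : ℕ) → IVec (dim r x)
aR2 r x k = if toℕ k <ᵇ x then + 0 else - (+ 1)

aR3 : (r x : ℕ) → IVec (dim r x)
aR3 r x k = + 0

aI : (r x : ℕ) → ℕ → IVec (dim r x)
aI r x i k = (+ (r ∸ i ℕ.+ 1)) ℤ.* aR1 r x k ℤ.+ aR2 r x k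

-- b'_j = e_{d-j+1}, for 1 ≤ j ≤ d  (0-based j' = j-1 gives index opposite j')
bJ : (r x : ℕ) → Fin (dim r x) → IVec (dim r x)
bJ r x j = e (opposite j)

allFinL : ∀ n → List (Fin n)
allFinL n = Data.List.allFin n

A′ : (r x : ℕ) → List (IVec (dim r x))
A′ r x =
  map (λ i → aI r x (suc i)) (upTo r)
  ++ (aR1 r x Data.List.∷ aR2 r x Data.List.∷ aR3 r x Data.List.∷ Data.List.[])
  ++ map (bJ r x) (allFinL (dim r x))

_∈V_ : ∀ {d} → IVec d → List (IVec d) → Set
z ∈V vs = Any (λ v → ∀ k → z k ≡ v k) vs

{-# OPTIONS --safe #-}
-- Write z = −t q + Σₖ μₖ eₖ.  The barycentric coordinates are forced: with N = 1 + Σ q and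
-- m = 1 − Σ z one gets t = m / N and μₖ = zₖ + t qₖ, so z ∈ Δ iff m ≥ 0 and N zₖ + m qₖ ≥ 0 for all k.
-- For q = (r^x, (1 + r x)^(r−1)) we have cₖ qₖ = N with c = ((1 + r x)^x, r^(r−1)), so the conditions
-- read cₖ zₖ + m ≥ 0.  For a lattice point with m = 0 they say z ≥ 0 and Σ z = 1, so z is some eᵢ.
-- For m = M ≥ 1 they say zₖ ≥ −⌊M / cₖ⌋, and these lower bounds sum to −(x g + (r − 1) p) with
-- g = ⌊M / (1 + r x)⌋ and p = ⌊M / r⌋, while Σ z = 1 − M.  Writing M = p r + β, this inequality
-- forces β ≤ 1, equality (so z is the vector of lower bounds), and (g, p) = (0, 1) or (g, g x + 1)
-- with 1 ≤ g ≤ r when β = 0, and (0, 0) or (1, x) when β = 1: these are exactly the a′ᵢ.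

module Submission where

open import Defs

module BlockProfiles where
  open import Data.Nat using (ℕ; zero; suc; _+_; _*_; _∸_; _≤_; _<_; s≤s; z≤n)
  import Data.Nat.Properties as ℕP
  import Data.Nat.Tactic.RingSolver as ℕRing
  open import Data.Product using (∃-syntax; _×_; _,_)
  open import Data.Empty using (⊥-elim)
  open import Relation.Binary.PropositionalEquality

  -- ((−g)^x, (−p)^(r−1)) is a′_{r+3}, a′_{r+2}, a′_{r+1}, or a′ᵢ with c = r − i + 1.
  data A′Block (r x : ℕ) : ℕ → ℕ → Set where
    a′₊₃ : A′Block r x 0 0
    a′₊₂ : A′Block r x 0 1
    a′₊₁ : A′Block r x 1 x
    a′ᵢ  : ∀ {c} → 1 ≤ c → c ≤ r → A′Block r x c (c * x + 1)

  coeff≤ : ∀ {r j} → j < r → r ∸ suc j + 1 ≤ r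
  coeff≤ {suc r′} {j} _ = subst (r′ ∸ j + 1 ≤_) (ℕP.+-comm r′ 1) (ℕP.+-monoˡ-≤ 1 (ℕP.m∸n≤m r′ j))

  coeff-index : ∀ {r c} → 1 ≤ c → c ≤ r → ∃[ j ] j < r × r ∸ suc j + 1 ≡ c
  coeff-index {suc r′} {suc c₀} _ (s≤s c₀≤r′) =
    r′ ∸ c₀ , s≤s (ℕP.m∸n≤m r′ c₀) , trans (cong (_+ 1) (ℕP.m∸[m∸n]≡n c₀≤r′)) (ℕP.+-comm c₀ 1)

  module _ (r′ x : ℕ) where
    private
      r = suc r′

    p+β≤1+xg : ∀ {g p β M′} → suc M′ ≡ β + p * r → M′ ≤ x * g + r′ * p → p + β ≤ 1 + x * g
    p+β≤1+xg {g} {p} {β} {M′} M≡ M′≤ =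
      ℕP.+-cancelʳ-≤ (r′ * p) _ _ (subst (_≤ suc (x * g + r′ * p)) (trans M≡ (regroup β p r′)) (s≤s M′≤))
      where
      regroup : ∀ β p r′ → β + p * suc r′ ≡ (p + β) + r′ * p
      regroup = ℕRing.solve-∀

    r′β+g≤r : ∀ {g p β M′} → suc M′ ≡ β + p * r → p + β ≤ 1 + x * g →
              g * (1 + r * x) ≤ suc M′ → r′ * β + g ≤ r
    r′β+g≤r {g} {p} {β} {M′} M≡ p+β≤ F = ℕP.+-cancelʳ-≤ (β + r * p + g * r * x) _ _
      (subst₂ _≤_ (lhs r′ x g p β) (rhs r′ x g p β)
        (ℕP.+-mono-≤ (ℕP.*-monoʳ-≤ r p+β≤) (subst (g * (1 + r * x) ≤_) M≡ F)))
      where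
      lhs : ∀ r′ x g p β → suc r′ * (p + β) + g * (1 + suc r′ * x)
                         ≡ (r′ * β + g) + (β + suc r′ * p + g * suc r′ * x)
      lhs = ℕRing.solve-∀
      rhs : ∀ r′ x g p β → suc r′ * (1 + x * g) + (β + p * suc r′)
                         ≡ suc r′ + (β + suc r′ * p + g * suc r′ * x)
      rhs = ℕRing.solve-∀

    profile-β≡0 : ∀ {g p M′} → suc M′ ≡ p * r → g * (1 + r * x) ≤ suc M′ → p ≤ 1 + x * g → g ≤ r →
                  M′ ≡ x * g + r′ * p × A′Block r x g p
    profile-β≡0 {zero} {zero}         ()  _ _   _
    profile-β≡0 {zero} {1}            M≡  _ _   _ = trans (ℕP.suc-injective M≡) (solve r′ x) , a′₊₂
      where
      solve : ∀ r′ x → r′ + 0 ≡ x * 0 + r′ * 1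
      solve = ℕRing.solve-∀
    profile-β≡0 {zero} {suc (suc p₀)} _   _ p≤1 _ with subst (λ n → 2 + p₀ ≤ 1 + n) (ℕP.*-zeroʳ x) p≤1
    ... | s≤s ()
    profile-β≡0 {suc g₀} {p} {M′}     M≡  F p≤  g≤r =
      subst (λ p → M′ ≡ x * g + r′ * p × A′Block r x g p) (sym p≡1+xg)
        ( trans (ℕP.suc-injective (trans M≡ (cong (_* r) p≡1+xg))) (solve r′ x g)
        , subst (A′Block r x g) (trans (ℕP.+-comm (g * x) 1) (cong suc (ℕP.*-comm g x))) (a′ᵢ (s≤s z≤n) g≤r))
      where
      g = suc g₀
      solve : ∀ r′ x g → r′ + x * g * suc r′ ≡ x * g + r′ * (1 + x * g)
      solve = ℕRing.solve-∀
      xgr<g[1+rx] : ∀ r′ x g₀ → suc (x * suc g₀ * suc r′) ≤ suc g₀ * (1 + suc r′ * x)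
      xgr<g[1+rx] r′ x g₀ = subst (suc (x * suc g₀ * suc r′) ≤_) (regroup r′ x g₀) (s≤s (ℕP.m≤n+m _ g₀))
        where
        regroup : ∀ r′ x g₀ → suc (g₀ + x * suc g₀ * suc r′) ≡ suc g₀ * (1 + suc r′ * x)
        regroup = ℕRing.solve-∀
      1+xg≤p : 1 + x * g ≤ p
      1+xg≤p = ℕP.≰⇒> λ p≤xg →
        ℕP.<⇒≱ (ℕP.≤-trans (xgr<g[1+rx] r′ x g₀) (subst (g * (1 + r * x) ≤_) M≡ F)) (ℕP.*-monoˡ-≤ r p≤xg)
      p≡1+xg : p ≡ 1 + x * g
      p≡1+xg = ℕP.≤-antisym p≤ 1+xg≤p

    profile-β≡1 : ∀ {g p M′} → suc M′ ≡ 1 + p * r → g * (1 + r * x) ≤ suc M′ → p ≤ x * g → g ≤ 1 →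
                  M′ ≡ x * g + r′ * p × A′Block r x g p
    profile-β≡1 {zero} {p} M≡ _ p≤0 _ with subst (p ≤_) (ℕP.*-zeroʳ x) p≤0
    ... | z≤n = trans (ℕP.suc-injective M≡) (solve r′ x) , a′₊₃
      where
      solve : ∀ r′ x → 0 ≡ x * 0 + r′ * 0
      solve = ℕRing.solve-∀
    profile-β≡1 {1} {p} {M′} M≡ F p≤x _ =
      subst (λ p → M′ ≡ x * 1 + r′ * p × A′Block r x 1 p) (sym p≡x)
        (trans (ℕP.suc-injective (trans M≡ (cong (λ p → 1 + p * r) p≡x))) (solve r′ x) , a′₊₁)
      where
      solve : ∀ r′ x → x * suc r′ ≡ x * 1 + r′ * x
      solve = ℕRing.solve-∀
      x≤p : x ≤ p
      x≤p = ℕP.*-cancelʳ-≤ x p r (subst (_≤ p * r) (ℕP.*-comm r x)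
              (ℕP.≤-pred (subst₂ _≤_ (cong suc (ℕP.+-identityʳ (r * x))) M≡ F)))
      p≡x : p ≡ x
      p≡x = ℕP.≤-antisym (subst (p ≤_) (ℕP.*-identityʳ x) p≤x) x≤p
    profile-β≡1 {suc (suc _)} _ _ _ (s≤s ())

    -- Used with M = M′ + 1 the slack of z, M = β + p r its division by r and g = ⌊M / (1 + r x)⌋;
    -- the last hypothesis says that Σ z = −M′ is at least the sum of the lower bounds −⌊M / cₖ⌋.
    floor-profile : ∀ {g p β M′} → suc M′ ≡ β + p * r → β < r → g * (1 + r * x) ≤ suc M′ →
                    M′ ≤ x * g + r′ * p → M′ ≡ x * g + r′ * p × A′Block r x g p
    floor-profile {g} {p} {zero} M≡ _ F M′≤ =
      profile-β≡0 M≡ F (subst (_≤ 1 + x * g) (ℕP.+-identityʳ p) p+β≤)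
                       (subst (λ n → n + g ≤ r) (ℕP.*-zeroʳ r′) (r′β+g≤r M≡ p+β≤ F))
      where p+β≤ = p+β≤1+xg M≡ M′≤
    floor-profile {g} {p} {1} M≡ _ F M′≤ =
      profile-β≡1 M≡ F (ℕP.+-cancelʳ-≤ 1 p (x * g) (subst (p + 1 ≤_) (ℕP.+-comm 1 (x * g)) p+β≤))
                       (ℕP.+-cancelˡ-≤ r′ g 1 (subst₂ _≤_ (cong (_+ g) (ℕP.*-identityʳ r′)) (ℕP.+-comm 1 r′)
                                                       (r′β+g≤r M≡ p+β≤ F)))
      where p+β≤ = p+β≤1+xg M≡ M′≤
    floor-profile {g} {p} {suc (suc β₀)} M≡ β<r F M′≤ = ⊥-elim (ℕP.<⇒≱ r′≥2 r′≤1)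
      where
      r′≥2 : 2 ≤ r′
      r′≥2 = ℕP.≤-trans (s≤s (s≤s z≤n)) (ℕP.≤-pred β<r)
      2r′≤r : r′ + r′ ≤ suc r′
      2r′≤r = ℕP.≤-trans (subst (_≤ r′ * suc (suc β₀)) (double r′) (ℕP.*-monoʳ-≤ r′ (s≤s (s≤s z≤n))))
                (ℕP.≤-trans (ℕP.m≤m+n _ g) (r′β+g≤r M≡ (p+β≤1+xg M≡ M′≤) F))
        where
        double : ∀ r′ → r′ * 2 ≡ r′ + r′
        double = ℕRing.solve-∀
      r′≤1 : r′ ≤ 1
      r′≤1 = ℕP.+-cancelˡ-≤ r′ r′ 1 (subst (r′ + r′ ≤_) (ℕP.+-comm 1 r′) 2r′≤r)

    A′Block⇒bounds : ∀ {g p} → A′Block r x g p →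
      (1 + r * x) * g ≤ 1 + (x * g + r′ * p) × r * p ≤ 1 + (x * g + r′ * p)
    A′Block⇒bounds a′₊₃ = 0≤ (1 + r * x) , 0≤ r
      where
      0≤ : ∀ c → c * 0 ≤ 1 + (x * 0 + r′ * 0)
      0≤ c = subst (_≤ 1 + (x * 0 + r′ * 0)) (sym (ℕP.*-zeroʳ c)) z≤n
    A′Block⇒bounds a′₊₂ =
      subst (_≤ 1 + (x * 0 + r′ * 1)) (sym (ℕP.*-zeroʳ (1 + r * x))) z≤n , ℕP.≤-reflexive (solve r′ x)
      where
      solve : ∀ r′ x → suc r′ * 1 ≡ 1 + (x * 0 + r′ * 1)
      solve = ℕRing.solve-∀
    A′Block⇒bounds a′₊₁ = ℕP.≤-reflexive (solve₁ r′ x) , subst (r * x ≤_) (solve₂ r′ x) (ℕP.n≤1+n (r * x))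
      where
      solve₁ : ∀ r′ x → (1 + suc r′ * x) * 1 ≡ 1 + (x * 1 + r′ * x)
      solve₁ = ℕRing.solve-∀
      solve₂ : ∀ r′ x → 1 + suc r′ * x ≡ 1 + (x * 1 + r′ * x)
      solve₂ = ℕRing.solve-∀
    A′Block⇒bounds (a′ᵢ {c} _ c≤r) =
      subst₂ _≤_ (solve₁ r′ x c) (solve₂ r′ x c) (ℕP.+-monoˡ-≤ (r * x * c) c≤r) ,
      ℕP.≤-reflexive (solve₃ r′ x c)
      where
      solve₁ : ∀ r′ x c → c + suc r′ * x * c ≡ (1 + suc r′ * x) * c
      solve₁ = ℕRing.solve-∀
      solve₂ : ∀ r′ x c → suc r′ + suc r′ * x * c ≡ 1 + (x * c + r′ * (c * x + 1))
      solve₂ = ℕRing.solve-∀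
      solve₃ : ∀ r′ x c → suc r′ * (c * x + 1) ≡ 1 + (x * c + r′ * (c * x + 1))
      solve₃ = ℕRing.solve-∀

module LatticePoints where
  open BlockProfiles
  open import Data.Nat as ℕ using (ℕ; zero; suc; _<ᵇ_; _∸_)
  import Data.Nat.Properties as ℕP
  open import Data.Integer as ℤ using (ℤ; +_; -[1+_]; +[1+_]; +0; _+_; _-_; _*_; -_; _≤_; _<_)
  import Data.Integer.Properties as ℤP
  import Data.Integer.Tactic.RingSolver as ℤRing
  import Data.Nat.Tactic.RingSolver as ℕRing
  open import Data.Rational as ℚ using (ℚ; mkℚ; 0ℚ; 1ℚ)
  import Data.Rational.Properties as ℚP
  open import Data.Rational.Solver using (module +-*-Solver)
  open import Data.Nat.Coprimality using (Coprime; 1-coprimeTo) renaming (sym to coprime-sym)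
  open import Data.Nat.DivMod using (_/_; m≡m%n+[m/n]*n; m%n<n; m/n*n≤m; m*n/n≡m; /-monoˡ-≤)
  open import Data.Fin as Fin using (Fin; toℕ; opposite)
  open import Data.Fin.Properties using (opposite-involutive)
  open import Data.Bool using (true; false; if_then_else_)
  import Data.Product as Product
  open import Data.Product using (∃-syntax; _×_; _,_; proj₁; proj₂)
  open import Data.Sum using (inj₁; inj₂)
  open import Data.Empty using (⊥-elim)
  open import Data.List using (_∷_; []; map; upTo; allFin)
  open import Data.List.Relation.Unary.Any using (here; there)
  open import Data.List.Relation.Unary.Any.Properties using (map⁺; map⁻; ++⁺ˡ; ++⁺ʳ; ++⁻)
  open import Data.List.Membership.Propositional using (lose; find)
  open import Data.List.Membership.Propositional.Properties using (∈-allFin; ∈-upTo⁺; ∈-upTo⁻)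
  open import Function using (_∘_; _⇔_; mk⇔; Equivalence)
  open import Function.Related.Propositional using (module EquationalReasoning)
  open import Relation.Nullary using (¬_; does)
  open import Relation.Binary.PropositionalEquality
  import Algebra.Properties.Semiring.Sum as SemiringSum
  open import Algebra.Properties.Group ℚP.+-0-group using () renaming (∙-cancelˡ to ℚ-+-cancelˡ)

  module ℤΣ = SemiringSum ℤP.+-*-semiring
  open ℤΣ using (sum; sum-cong-≗)

  ι : ℤ → ℚ
  ι i = ℚ._/_ i 1

  private
    coprime-1 : ∀ n → Coprime n 1
    coprime-1 n = coprime-sym (1-coprimeTo n)

  ι≡mkℚ : ∀ i → ι i ≡ mkℚ i 0 (coprime-1 ℤ.∣ i ∣)
  ι≡mkℚ (+ n)    = ℚP.normalize-coprime (coprime-1 n)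
  ι≡mkℚ -[1+ n ] = cong ℚ.-_ (ℚP.normalize-coprime (coprime-1 (suc n)))

  ι-homo-+ : ∀ i j → ι (i + j) ≡ ι i ℚ.+ ι j
  ι-homo-+ i j rewrite ι≡mkℚ i | ι≡mkℚ j =
    ℚP./-cong {p₁ = i + j} (cong₂ _+_ (sym (ℤP.*-identityʳ i)) (sym (ℤP.*-identityʳ j))) refl

  ι-homo-* : ∀ i j → ι (i * j) ≡ ι i ℚ.* ι j
  ι-homo-* i j rewrite ι≡mkℚ i | ι≡mkℚ j = refl

  ι-homo-‿- : ∀ i → ι (- i) ≡ ℚ.- ι i
  ι-homo-‿- +0       = refl
  ι-homo-‿- +[1+ n ] = refl
  ι-homo-‿- -[1+ n ] rewrite ι≡mkℚ +[1+ n ] = refl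

  ι-mono-≤ : ∀ {i j} → i ≤ j → ι i ℚ.≤ ι j
  ι-mono-≤ {i} {j} i≤j rewrite ι≡mkℚ i | ι≡mkℚ j =
    ℚ.*≤* (subst₂ _≤_ (sym (ℤP.*-identityʳ i)) (sym (ℤP.*-identityʳ j)) i≤j)

  ι-cancel-≤ : ∀ {i j} → ι i ℚ.≤ ι j → i ≤ j
  ι-cancel-≤ {i} {j} ιi≤ιj rewrite ι≡mkℚ i | ι≡mkℚ j =
    subst₂ _≤_ (ℤP.*-identityʳ i) (ℤP.*-identityʳ j) (ℚP.drop-*≤* ιi≤ιj)

  ℚ-*-nonNeg : ∀ {a b} → 0ℚ ℚ.≤ a → 0ℚ ℚ.≤ b → 0ℚ ℚ.≤ a ℚ.* b
  ℚ-*-nonNeg {a} {b} 0≤a 0≤b =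
    ℚP.nonNegative⁻¹ _ {{ℚP.nonNeg*nonNeg⇒nonNeg a {{ℚ.nonNegative 0≤a}} b {{ℚ.nonNegative 0≤b}}}}

  sumFin-cong : ∀ {n} {f g : Fin n → ℚ} → (∀ i → f i ≡ g i) → sumFin f ≡ sumFin g
  sumFin-cong {zero}  f≗g = refl
  sumFin-cong {suc n} f≗g = cong₂ ℚ._+_ (f≗g Fin.zero) (sumFin-cong (f≗g ∘ Fin.suc))

  sumFin-affine : ∀ {n} (z q : Fin n → ℤ) t →
    sumFin (λ k → ι (z k) ℚ.+ t ℚ.* ι (q k)) ≡ ι (sum z) ℚ.+ t ℚ.* ι (sum q)
  sumFin-affine {zero}  z q t = sym (trans (ℚP.+-identityˡ _) (ℚP.*-zeroʳ t))
  sumFin-affine {suc n} z q t = begin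
    (ι z₀ ℚ.+ t ℚ.* ι q₀) ℚ.+ sumFin (λ k → ι (z (Fin.suc k)) ℚ.+ t ℚ.* ι (q (Fin.suc k)))
      ≡⟨ cong ((ι z₀ ℚ.+ t ℚ.* ι q₀) ℚ.+_) (sumFin-affine (z ∘ Fin.suc) (q ∘ Fin.suc) t) ⟩
    (ι z₀ ℚ.+ t ℚ.* ι q₀) ℚ.+ (ι (sum (z ∘ Fin.suc)) ℚ.+ t ℚ.* ι (sum (q ∘ Fin.suc)))
      ≡⟨ solve 5 (λ a b c d t → (a :+ t :* b) :+ (c :+ t :* d) := (a :+ c) :+ t :* (b :+ d))
               refl (ι z₀) (ι q₀) (ι (sum (z ∘ Fin.suc))) (ι (sum (q ∘ Fin.suc))) t ⟩
    (ι z₀ ℚ.+ ι (sum (z ∘ Fin.suc))) ℚ.+ t ℚ.* (ι q₀ ℚ.+ ι (sum (q ∘ Fin.suc)))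
      ≡⟨ sym (cong₂ (λ a b → a ℚ.+ t ℚ.* b) (ι-homo-+ z₀ _) (ι-homo-+ q₀ _)) ⟩
    ι (sum z) ℚ.+ t ℚ.* ι (sum q) ∎
    where
    open ≡-Reasoning
    open +-*-Solver
    z₀ = z Fin.zero
    q₀ = q Fin.zero

  sumFin-0 : ∀ n → sumFin {n} (λ _ → 0ℚ) ≡ 0ℚ
  sumFin-0 zero    = refl
  sumFin-0 (suc n) = trans (ℚP.+-identityˡ _) (sumFin-0 n)

  sumFin-*-e : ∀ {d} (f : Fin d → ℚ) k → sumFin (λ i → f i ℚ.* ι (e i k)) ≡ f k
  sumFin-*-e {suc d} f Fin.zero
    rewrite sumFin-cong (ℚP.*-zeroʳ ∘ f ∘ Fin.suc) | sumFin-0 d | ℚP.*-identityʳ (f Fin.zero) = ℚP.+-identityʳ _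
  sumFin-*-e {suc d} f (Fin.suc k) rewrite sumFin-*-e (f ∘ Fin.suc) k | ℚP.*-zeroʳ (f Fin.zero) = ℚP.+-identityˡ _

  sum-mono-≤ : ∀ {n} {u v : Fin n → ℤ} → (∀ k → u k ≤ v k) → sum u ≤ sum v
  sum-mono-≤ {zero}  u≤v = ℤP.≤-refl
  sum-mono-≤ {suc n} u≤v = ℤP.+-mono-≤ (u≤v Fin.zero) (sum-mono-≤ (u≤v ∘ Fin.suc))

  sum-nonNeg : ∀ {n} {z : Fin n → ℤ} → (∀ k → +0 ≤ z k) → +0 ≤ sum z
  sum-nonNeg {n} {z} z≥0 = subst (_≤ sum z) (ℤΣ.sum-replicate-zero n) (sum-mono-≤ z≥0)

  ≤∧sum≥⇒≗ : ∀ {n} {u v : Fin n → ℤ} → (∀ k → u k ≤ v k) → sum v ≤ sum u → u ≗ v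
  ≤∧sum≥⇒≗ {suc n} {u} {v} u≤v Σv≤Σu Fin.zero =
    ℤP.≤-antisym (u≤v Fin.zero) (ℤP.≮⇒≥ λ u₀<v₀ →
      ℤP.<⇒≱ (ℤP.+-mono-<-≤ u₀<v₀ (sum-mono-≤ (u≤v ∘ Fin.suc))) Σv≤Σu)
  ≤∧sum≥⇒≗ {suc n} {u} {v} u≤v Σv≤Σu (Fin.suc k) =
    ≤∧sum≥⇒≗ (u≤v ∘ Fin.suc) (ℤP.≮⇒≥ λ Σu′<Σv′ →
      ℤP.<⇒≱ (ℤP.+-mono-≤-< (u≤v Fin.zero) Σu′<Σv′) Σv≤Σu) k

  sum-e : ∀ {n} (i : Fin n) → sum (e i) ≡ + 1
  sum-e {suc n} Fin.zero    = cong (λ s → + 1 + s) (ℤΣ.sum-replicate-zero n)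
  sum-e {suc n} (Fin.suc i) = trans (ℤP.+-identityˡ _) (sum-e i)

  sum-const : ∀ n a → sum {n} (λ _ → a) ≡ + n * a
  sum-const zero    a = sym (ℤP.*-zeroˡ a)
  sum-const (suc n) a = trans (cong (_+_ a) (sum-const n a)) (lemma a (+ n))
    where
    lemma : ∀ a n → a + n * a ≡ (+ 1 + n) * a
    lemma = ℤRing.solve-∀

  nonNeg∧sum≡1⇒basis : ∀ {n} (z : Fin n → ℤ) → (∀ k → +0 ≤ z k) → sum z ≡ + 1 → ∃[ i ] z ≗ e i
  nonNeg∧sum≡1⇒basis {suc n} z z≥0 Σz≡1 = split (z Fin.zero) refl
    where
    z′ = z ∘ Fin.suc
    Σz′≥0 : +0 ≤ sum z′
    Σz′≥0 = sum-nonNeg (z≥0 ∘ Fin.suc)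
    Σz≡z₀+Σz′ : ∀ {a} → z Fin.zero ≡ a → + 1 ≡ a + sum z′
    Σz≡z₀+Σz′ z₀≡a = trans (sym Σz≡1) (cong (_+ sum z′) z₀≡a)
    split : ∀ a → z Fin.zero ≡ a → ∃[ i ] z ≗ e i
    split +0 z₀≡0
      with nonNeg∧sum≡1⇒basis z′ (z≥0 ∘ Fin.suc) (sym (trans (Σz≡z₀+Σz′ z₀≡0) (ℤP.+-identityˡ _)))
    ... | i , z′≗eᵢ = Fin.suc i , λ { Fin.zero → z₀≡0 ; (Fin.suc k) → z′≗eᵢ k }
    split (+ 1) z₀≡1 = Fin.zero , λ { Fin.zero → z₀≡1 ; (Fin.suc k) → sym (z′≗0 k) }
      where
      Σz′≡0 : sum z′ ≡ +0
      Σz′≡0 = trans (solve (sum z′)) (cong (_- + 1) (sym (Σz≡z₀+Σz′ z₀≡1)))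
        where
        solve : ∀ s → s ≡ (+ 1 + s) - + 1
        solve = ℤRing.solve-∀
      z′≗0 : (λ _ → +0) ≗ z′
      z′≗0 = ≤∧sum≥⇒≗ (z≥0 ∘ Fin.suc) (ℤP.≤-reflexive (trans Σz′≡0 (sym (ℤΣ.sum-replicate-zero n))))
    split +[1+ suc m ] z₀≡2+m =
      ⊥-elim (two≰one (ℤP.drop‿+≤+ (subst (+[1+ suc m ] ≤_) (sym (Σz≡z₀+Σz′ z₀≡2+m))
                                          (ℤP.i≤i+j _ (sum z′) {{ℤ.nonNegative Σz′≥0}}))))
      where
      two≰one : ¬ (2 ℕ.+ m ℕ.≤ 1)
      two≰one (ℕ.s≤s ())
    split -[1+ m ] z₀≡neg with subst (+0 ≤_) z₀≡neg (z≥0 Fin.zero)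
    ... | ()

  ℤ-*-nonNeg : ∀ {a b} → +0 ≤ a → +0 ≤ b → +0 ≤ a * b
  ℤ-*-nonNeg {+ a} {+ b} _ _ = subst (+0 ≤_) (ℤP.pos-* a b) (ℤ.+≤+ ℕ.z≤n)

  e-nonNeg : ∀ {n} (i k : Fin n) → +0 ≤ e i k
  e-nonNeg i k with does (i Fin.≟ k)
  ... | true  = ℤ.+≤+ ℕ.z≤n
  ... | false = ℤ.+≤+ ℕ.z≤n

  blockVec : ∀ {n} → ℕ → ℤ → ℤ → IVec n
  blockVec x a b k = if toℕ k <ᵇ x then a else b

  blockVec-elim : ∀ {n} x {a b} (P : ℤ → Set) → P a → P b → (k : Fin n) → P (blockVec x a b k)
  blockVec-elim x P Pa Pb k with toℕ k <ᵇ x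
  ... | true  = Pa
  ... | false = Pb

  blockVec-zipWith : ∀ {n} x (f : ℤ → ℤ → ℤ) a b a′ b′ (k : Fin n) →
    f (blockVec x a b k) (blockVec x a′ b′ k) ≡ blockVec x (f a a′) (f b b′) k
  blockVec-zipWith x f a b a′ b′ k with toℕ k <ᵇ x
  ... | true  = refl
  ... | false = refl

  sum-blockVec : ∀ x y a b → sum {x ℕ.+ y} (blockVec x a b) ≡ + x * a + + y * b
  sum-blockVec zero    y a b = trans (sum-const y b) (sym (ℤP.+-identityˡ _))
  sum-blockVec (suc x) y a b = trans (cong (_+_ a) (sum-blockVec x y a b)) (lemma a b (+ x) (+ y))
    where
    lemma : ∀ a b x y → a + (x * a + y * b) ≡ (+ 1 + x) * a + y * b
    lemma = ℤRing.solve-∀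

  sum-negBlock : ∀ x y g p → sum {x ℕ.+ y} (blockVec x (- + g) (- + p)) ≡ - + (x ℕ.* g ℕ.+ y ℕ.* p)
  sum-negBlock x y g p = begin
    sum {x ℕ.+ y} (blockVec x (- + g) (- + p)) ≡⟨ sum-blockVec x y (- + g) (- + p) ⟩
    + x * - + g + + y * - + p            ≡⟨ solve (+ x) (+ g) (+ y) (+ p) ⟩
    - (+ x * + g + + y * + p)            ≡⟨ cong -_ (sym (cong₂ _+_ (ℤP.pos-* x g) (ℤP.pos-* y p))) ⟩
    - (+ (x ℕ.* g) + + (y ℕ.* p))        ≡⟨ cong -_ (sym (ℤP.pos-+ (x ℕ.* g) (y ℕ.* p))) ⟩
    - + (x ℕ.* g ℕ.+ y ℕ.* p)            ∎
    where
    open ≡-Reasoning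
    solve : ∀ x g y p → x * - g + y * - p ≡ - (x * g + y * p)
    solve = ℤRing.solve-∀

  -- Barycentric coordinates in conv {−q, e₁, …, e_d}

  InConv-resp-≗ : ∀ {d n} {vs ws : Fin n → IVec d} {z} → (∀ i → vs i ≗ ws i) → InConv vs z → InConv ws z
  InConv-resp-≗ vs≗ws (λs , λs≥0 , Σλs≡1 , z≡) =
    λs , λs≥0 , Σλs≡1 , λ k → trans (z≡ k) (sumFin-cong λ i → cong (λ a → λs i ℚ.* ι a) (vs≗ws i k))

  Δ-vertices : ∀ {d} → IVec d → Fin (suc d) → IVec d
  Δ-vertices q Fin.zero    k = - q k
  Δ-vertices q (Fin.suc i) = e i

  slack : ∀ {d} → IVec d → ℤ
  slack z = + 1 - sum z

  slack≡⇒sum≡ : ∀ {n} {z : IVec n} {m} → slack z ≡ m → sum z ≡ + 1 - m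
  slack≡⇒sum≡ {z = z} refl = solve (sum z)
    where
    solve : ∀ s → s ≡ + 1 - (+ 1 - s)
    solve = ℤRing.solve-∀

  -- With N = 1 + Σ q, the barycentric coordinates of z with respect to −q, e₁, …, e_d are
  -- t = slack z / N at −q and zₖ + t qₖ at eₖ; InΔ q z says that N times each of them is nonnegative.
  InΔ : ∀ {d} → IVec d → IVec d → Set
  InΔ q z = +0 ≤ slack z × (∀ k → +0 ≤ (+ 1 + sum q) * z k + slack z * q k)

  module _ {d} (q z : IVec d) where
    private
      N = + 1 + sum q

      μ : ℚ → Fin d → ℚ
      μ t k = ι (z k) ℚ.+ t ℚ.* ι (q k)

      t+Σμ≡ : ∀ t → t ℚ.+ sumFin (μ t) ≡ t ℚ.* ι N ℚ.+ ι (sum z)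
      t+Σμ≡ t = begin
        t ℚ.+ sumFin (μ t)
          ≡⟨ cong (t ℚ.+_) (sumFin-affine z q t) ⟩
        t ℚ.+ (ι (sum z) ℚ.+ t ℚ.* ι (sum q))
          ≡⟨ solve 3 (λ t Z Q → t :+ (Z :+ t :* Q) := t :* (con 1ℚ :+ Q) :+ Z) refl t (ι (sum z)) (ι (sum q)) ⟩
        t ℚ.* (1ℚ ℚ.+ ι (sum q)) ℚ.+ ι (sum z)
          ≡⟨ cong (λ a → t ℚ.* a ℚ.+ ι (sum z)) (sym (ι-homo-+ (+ 1) (sum q))) ⟩
        t ℚ.* ι N ℚ.+ ι (sum z) ∎
        where
          open ≡-Reasoning
          open +-*-Solver

      Nμ≡ : ∀ t → t ℚ.* ι N ≡ ι (slack z) → ∀ k → ι (N * z k + slack z * q k) ≡ ι N ℚ.* μ t k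
      Nμ≡ t tN≡m k = begin
        ι (N * z k + slack z * q k)
          ≡⟨ ι-homo-+ (N * z k) (slack z * q k) ⟩
        ι (N * z k) ℚ.+ ι (slack z * q k)
          ≡⟨ cong₂ ℚ._+_ (ι-homo-* N (z k)) (ι-homo-* (slack z) (q k)) ⟩
        ι N ℚ.* ι (z k) ℚ.+ ι (slack z) ℚ.* ι (q k)
          ≡⟨ cong (λ a → ι N ℚ.* ι (z k) ℚ.+ a ℚ.* ι (q k)) (sym tN≡m) ⟩
        ι N ℚ.* ι (z k) ℚ.+ t ℚ.* ι N ℚ.* ι (q k)
          ≡⟨ solve 4 (λ n Z t Q → n :* Z :+ t :* n :* Q := n :* (Z :+ t :* Q)) refl (ι N) (ι (z k)) t (ι (q k)) ⟩
        ι N ℚ.* μ t k ∎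
        where
          open ≡-Reasoning
          open +-*-Solver

      vertex-sum : ∀ (λs : Fin (suc d) → ℚ) k →
        sumFin (λ i → λs i ℚ.* ι (Δ-vertices q i k)) ≡ λs Fin.zero ℚ.* ι (- q k) ℚ.+ λs (Fin.suc k)
      vertex-sum λs k = cong (λs Fin.zero ℚ.* ι (- q k) ℚ.+_) (sumFin-*-e (λs ∘ Fin.suc) k)

      z≡-t*q+μ : ∀ t k → ι (z k) ≡ t ℚ.* ι (- q k) ℚ.+ μ t k
      z≡-t*q+μ t k = begin
        ι (z k)
          ≡⟨ solve 3 (λ Z t Q → Z := t :* (:- Q) :+ (Z :+ t :* Q)) refl (ι (z k)) t (ι (q k)) ⟩
        t ℚ.* ℚ.- ι (q k) ℚ.+ μ t k
          ≡⟨ cong (λ a → t ℚ.* a ℚ.+ μ t k) (sym (ι-homo-‿- (q k))) ⟩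
        t ℚ.* ι (- q k) ℚ.+ μ t k ∎
        where
          open ≡-Reasoning
          open +-*-Solver

    module _ (q≥0 : ∀ k → +0 ≤ q k) where
      private
        s = ℤ.∣ sum q ∣

        N≡1+s : N ≡ + suc s
        N≡1+s = cong (λ a → + 1 + a) (sym (ℤP.0≤i⇒+∣i∣≡i (sum-nonNeg q≥0)))

        ιN≥0 : 0ℚ ℚ.≤ ι N
        ιN≥0 = ι-mono-≤ (subst (+0 ≤_) (sym N≡1+s) (ℤ.+≤+ ℕ.z≤n))

        N′ : ℚ
        N′ = mkℚ +[1+ s ] 0 (coprime-1 (suc s))

        N⁻¹ : ℚ
        N⁻¹ = ℚ.1/ N′

        N⁻¹*ιN≡1 : N⁻¹ ℚ.* ι N ≡ 1ℚ
        N⁻¹*ιN≡1 =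
          trans (cong (λ a → N⁻¹ ℚ.* ι a) N≡1+s) (trans (cong (N⁻¹ ℚ.*_) (ι≡mkℚ +[1+ s ])) (ℚP.*-inverseˡ N′))

      InConv-Δ⇒InΔ : InConv (Δ-vertices q) z → InΔ q z
      InConv-Δ⇒InΔ (λs , λs≥0 , Σλs≡1 , z≡Σ) =
        ι-cancel-≤ (subst (0ℚ ℚ.≤_) tN≡m (ℚ-*-nonNeg (λs≥0 Fin.zero) ιN≥0)) ,
        λ k → ι-cancel-≤ (subst (0ℚ ℚ.≤_) (sym (Nμ≡ t tN≡m k))
                           (ℚ-*-nonNeg ιN≥0 (subst (0ℚ ℚ.≤_) (λs≡μ k) (λs≥0 (Fin.suc k)))))
        where
        t = λs Fin.zero
        λs≡μ : ∀ k → λs (Fin.suc k) ≡ μ t k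
        λs≡μ k = ℚ-+-cancelˡ (t ℚ.* ι (- q k)) _ _ (trans (sym (trans (z≡Σ k) (vertex-sum λs k))) (z≡-t*q+μ t k))
        tN≡m : t ℚ.* ι N ≡ ι (slack z)
        tN≡m = begin
          t ℚ.* ι N
            ≡⟨ solve 2 (λ a Z → a := (a :+ Z) :+ (:- Z)) refl (t ℚ.* ι N) (ι (sum z)) ⟩
          (t ℚ.* ι N ℚ.+ ι (sum z)) ℚ.+ ℚ.- ι (sum z)
            ≡⟨ cong (ℚ._+ ℚ.- ι (sum z)) (sym (t+Σμ≡ t)) ⟩
          (t ℚ.+ sumFin (μ t)) ℚ.+ ℚ.- ι (sum z)
            ≡⟨ cong (λ a → (t ℚ.+ a) ℚ.+ ℚ.- ι (sum z)) (sumFin-cong (sym ∘ λs≡μ)) ⟩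
          sumFin λs ℚ.+ ℚ.- ι (sum z)
            ≡⟨ cong₂ ℚ._+_ Σλs≡1 (sym (ι-homo-‿- (sum z))) ⟩
          1ℚ ℚ.+ ι (- sum z)
            ≡⟨ sym (ι-homo-+ (+ 1) (- sum z)) ⟩
          ι (slack z) ∎
          where
            open ≡-Reasoning
            open +-*-Solver

      InΔ⇒InConv-Δ : InΔ q z → InConv (Δ-vertices q) z
      InΔ⇒InConv-Δ (m≥0 , Nz+mq≥0) = λs , λs≥0 , Σλs≡1 , λ k → trans (z≡-t*q+μ t k) (sym (vertex-sum λs k))
        where
        t = ι (slack z) ℚ.* N⁻¹
        tN≡m : t ℚ.* ι N ≡ ι (slack z)
        tN≡m = trans (ℚP.*-assoc (ι (slack z)) N⁻¹ (ι N))
                     (trans (cong (ι (slack z) ℚ.*_) N⁻¹*ιN≡1) (ℚP.*-identityʳ _))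
        λs : Fin (suc d) → ℚ
        λs Fin.zero    = t
        λs (Fin.suc k) = μ t k
        N⁻¹≥0 : 0ℚ ℚ.≤ N⁻¹
        N⁻¹≥0 = ℚP.nonNegative⁻¹ N⁻¹
        μ≡N⁻¹*Nμ : ∀ k → N⁻¹ ℚ.* (ι N ℚ.* μ t k) ≡ μ t k
        μ≡N⁻¹*Nμ k = trans (sym (ℚP.*-assoc N⁻¹ (ι N) (μ t k)))
                           (trans (cong (ℚ._* μ t k) N⁻¹*ιN≡1) (ℚP.*-identityˡ _))
        λs≥0 : ∀ i → 0ℚ ℚ.≤ λs i
        λs≥0 Fin.zero    = ℚ-*-nonNeg (ι-mono-≤ m≥0) N⁻¹≥0
        λs≥0 (Fin.suc k) = subst (0ℚ ℚ.≤_) (μ≡N⁻¹*Nμ k)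
          (ℚ-*-nonNeg N⁻¹≥0 (subst (0ℚ ℚ.≤_) (Nμ≡ t tN≡m k) (ι-mono-≤ (Nz+mq≥0 k))))
        Σλs≡1 : sumFin λs ≡ 1ℚ
        Σλs≡1 = begin
          t ℚ.+ sumFin (μ t)                   ≡⟨ t+Σμ≡ t ⟩
          t ℚ.* ι N ℚ.+ ι (sum z)              ≡⟨ cong (ℚ._+ ι (sum z)) tN≡m ⟩
          ι (slack z) ℚ.+ ι (sum z)            ≡⟨ sym (ι-homo-+ (slack z) (sum z)) ⟩
          ι (slack z + sum z)                  ≡⟨ cong ι (slack+sum (sum z)) ⟩
          1ℚ                                   ∎
          where
          open ≡-Reasoning
          slack+sum : ∀ a → (+ 1 - a) + a ≡ + 1
          slack+sum = ℤRing.solve-∀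

    InConv-Δ⇔InΔ : (∀ k → +0 ≤ q k) → InConv (Δ-vertices q) z ⇔ InΔ q z
    InConv-Δ⇔InΔ q≥0 = mk⇔ (InConv-Δ⇒InΔ q≥0) (InΔ⇒InConv-Δ q≥0)

  0≤N*z+m*q⇔0≤c*z+m : ∀ c q {N} z m → +0 < q → c * q ≡ N → (+0 ≤ N * z + m * q ⇔ +0 ≤ c * z + m)
  0≤N*z+m*q⇔0≤c*z+m c q z m 0<q refl = mk⇔
    (λ 0≤q[cz+m] → ℤP.*-cancelˡ-≤-pos +0 (c * z + m) q {{q⁺}} (subst₂ _≤_ (sym (ℤP.*-zeroʳ q)) factor 0≤q[cz+m]))
    (λ 0≤cz+m → subst₂ _≤_ (ℤP.*-zeroʳ q) (sym factor) (ℤP.*-monoˡ-≤-nonNeg q {{q⁰⁺}} 0≤cz+m))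
    where
    q⁺ = ℤ.positive 0<q
    q⁰⁺ = ℤ.nonNegative (ℤP.<⇒≤ 0<q)
    factor : (c * q) * z + m * q ≡ q * (c * z + m)
    factor = solve c q z m
      where
      solve : ∀ c q z m → (c * q) * z + m * q ≡ q * (c * z + m)
      solve = ℤRing.solve-∀

  0≤c*w+M⇒-[M/c]≤w : ∀ c M w → +0 ≤ + suc c * w + + M → - + (M / suc c) ≤ w
  0≤c*w+M⇒-[M/c]≤w c M (+ n)    _   = ℤP.neg-≤-pos
  0≤c*w+M⇒-[M/c]≤w c M -[1+ n ] 0≤h =
    ℤP.neg-mono-≤ (ℤ.+≤+ (subst (ℕ._≤ M / suc c) (m*n/n≡m (suc n) (suc c)) (/-monoˡ-≤ (suc c) n*c≤M)))
    where
    n*c≤M : suc n ℕ.* suc c ℕ.≤ M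
    n*c≤M = subst (ℕ._≤ M) (ℕP.*-comm (suc c) (suc n))
              -- + suc c * -[1+ n ] is definitionally - + (suc c * suc n).
              (ℤP.drop‿+≤+ (ℤP.0≤i-j⇒j≤i (subst (+0 ≤_) (ℤP.+-comm (+ suc c * -[1+ n ]) (+ M)) 0≤h)))

  0≤c*-g+m : ∀ c g m → c ℕ.* g ℕ.≤ m → +0 ≤ + c * - + g + + m
  0≤c*-g+m c g m cg≤m = subst (+0 ≤_) (sym c*-g+m≡m∸cg) (ℤ.+≤+ ℕ.z≤n)
    where
    c*-g+m≡m∸cg : + c * - + g + + m ≡ + (m ∸ c ℕ.* g)
    c*-g+m≡m∸cg = begin
      + c * - + g + + m       ≡⟨ cong (_+ + m) (sym (ℤP.neg-distribʳ-* (+ c) (+ g))) ⟩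
      - (+ c * + g) + + m     ≡⟨ cong (λ a → - a + + m) (sym (ℤP.pos-* c g)) ⟩
      - + (c ℕ.* g) + + m     ≡⟨ ℤP.+-comm (- + (c ℕ.* g)) (+ m) ⟩
      + m - + (c ℕ.* g)       ≡⟨ ℤP.m-n≡m⊖n m (c ℕ.* g) ⟩
      m ℤ.⊖ c ℕ.* g           ≡⟨ ℤP.⊖-≥ cg≤m ⟩
      + (m ∸ c ℕ.* g)         ∎
      where
        open ≡-Reasoning

  data A′Point (r x : ℕ) (z : IVec (dim r x)) : Set where
    basis : ∀ i → z ≗ e i → A′Point r x z
    block : ∀ {g p} → A′Block r x g p → z ≗ blockVec x (- + g) (- + p) → A′Point r x z

  aR3≗block : ∀ r x → aR3 r x ≗ blockVec x (- + 0) (- + 0)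
  aR3≗block r x = blockVec-elim x (+0 ≡_) refl refl

  aI≗block : ∀ r x i → aI r x i ≗ blockVec x (- + (r ∸ i ℕ.+ 1)) (- + ((r ∸ i ℕ.+ 1) ℕ.* x ℕ.+ 1))
  aI≗block r x i k =
    trans (blockVec-zipWith x (λ a b → + c * a + b) (- + 1) (- + x) +0 (- + 1) k)
          (cong₂ (λ a b → blockVec x a b k) (solve₁ (+ c))
                 (trans (solve₂ (+ c) (+ x)) (cong (λ a → - (a + + 1)) (sym (ℤP.pos-* c x)))))
    where
    c = r ∸ i ℕ.+ 1
    solve₁ : ∀ c → c * - + 1 + +0 ≡ - c
    solve₁ = ℤRing.solve-∀
    solve₂ : ∀ c x → c * - x + - + 1 ≡ - (c * x + + 1)
    solve₂ = ℤRing.solve-∀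

  A′Point⇔∈A′ : ∀ r x z → A′Point r x z ⇔ z ∈V A′ r x
  A′Point⇔∈A′ r x z = mk⇔ locate classify
    where
    as = map (λ i → aI r x (suc i)) (upTo r)
    a₊ = aR1 r x ∷ aR2 r x ∷ aR3 r x ∷ []
    bs = map (bJ r x) (allFin (dim r x))

    classify : z ∈V A′ r x → A′Point r x z
    classify z∈ with ++⁻ as z∈
    ... | inj₁ z∈as with find (map⁻ z∈as)
    ...   | j , j∈ , z≗aⱼ =
      block (a′ᵢ (ℕP.m≤n+m 1 (r ∸ suc j)) (coeff≤ (∈-upTo⁻ j∈))) (λ k → trans (z≗aⱼ k) (aI≗block r x (suc j) k))
    classify z∈ | inj₂ z∈rest with ++⁻ a₊ z∈rest
    ... | inj₁ (here z≗a₊₁)                 = block a′₊₁ z≗a₊₁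
    ... | inj₁ (there (here z≗a₊₂))         = block a′₊₂ z≗a₊₂
    ... | inj₁ (there (there (here z≗a₊₃))) = block a′₊₃ (λ k → trans (z≗a₊₃ k) (aR3≗block r x k))
    ... | inj₂ z∈bs with find (map⁻ z∈bs)
    ...   | j , _ , z≗bⱼ = basis (opposite j) z≗bⱼ

    locate : A′Point r x z → z ∈V A′ r x
    locate (basis i z≗eᵢ) = ++⁺ʳ as (++⁺ʳ a₊ (map⁺ (lose (∈-allFin (opposite i))
      (λ k → trans (z≗eᵢ k) (cong (λ j → e j k) (sym (opposite-involutive i)))))))
    locate (block a′₊₁ z≗) = ++⁺ʳ as (++⁺ˡ {ys = bs} (here z≗))
    locate (block a′₊₂ z≗) = ++⁺ʳ as (++⁺ˡ {ys = bs} (there (here z≗)))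
    locate (block a′₊₃ z≗) =
      ++⁺ʳ as (++⁺ˡ {ys = bs} (there (there (here (λ k → trans (z≗ k) (sym (aR3≗block r x k)))))))
    locate (block (a′ᵢ 1≤c c≤r) z≗) with coeff-index 1≤c c≤r
    ... | j , j<r , refl = ++⁺ˡ (map⁺ (lose (∈-upTo⁺ j<r) (λ k → trans (z≗ k) (sym (aI≗block r x (suc j) k)))))

  -- Δ_(1,q) for q = (r^x, (1 + r x)^(r−1))

  module _ (r′ x : ℕ) where
    private
      r = suc r′
      N = r ℕ.* (1 ℕ.+ r ℕ.* x)

    -- cₖ qₖ = r (1 + r x) = 1 + Σ q for every k.
    facetWeight : IVec (x ℕ.+ r′)
    facetWeight = blockVec x (+ (1 ℕ.+ r ℕ.* x)) (+ r)

    FacetIneqs : IVec (x ℕ.+ r′) → Set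
    FacetIneqs z = +0 ≤ slack z × (∀ k → +0 ≤ facetWeight k * z k + slack z)

    private
      1+Σq≡N : + 1 + sum (qvec r x) ≡ + N
      1+Σq≡N = begin
        + 1 + sum (qvec r x)
          ≡⟨ cong (λ a → + 1 + a) (sum-blockVec x r′ (+ r) (+ (1 ℕ.+ r ℕ.* x))) ⟩
        + 1 + (+ x * + r + + r′ * + (1 ℕ.+ r ℕ.* x))
          ≡⟨ cong (λ a → + 1 + a) (sym (cong₂ _+_ (ℤP.pos-* x r) (ℤP.pos-* r′ _))) ⟩
        + (1 ℕ.+ (x ℕ.* r ℕ.+ r′ ℕ.* (1 ℕ.+ r ℕ.* x)))
          ≡⟨ cong +_ (solve r′ x) ⟩
        + N ∎
        where
        open ≡-Reasoning
        solve : ∀ r′ x →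
          1 ℕ.+ (x ℕ.* suc r′ ℕ.+ r′ ℕ.* (1 ℕ.+ suc r′ ℕ.* x)) ≡ suc r′ ℕ.* (1 ℕ.+ suc r′ ℕ.* x)
        solve = ℕRing.solve-∀

      c*q≡N : ∀ k → facetWeight k * qvec r x k ≡ + N
      c*q≡N k = trans (blockVec-zipWith x _*_ _ _ _ _ k)
                      (blockVec-elim x (_≡ + N) (trans (sym (ℤP.pos-* (1 ℕ.+ r ℕ.* x) r)) (cong +_ (ℕP.*-comm (1 ℕ.+ r ℕ.* x) r)))
                                            (sym (ℤP.pos-* r (1 ℕ.+ r ℕ.* x))) k)

      q>0 : ∀ k → +0 < qvec r x k
      q>0 = blockVec-elim x (+0 <_) (ℤ.+<+ (ℕ.s≤s ℕ.z≤n)) (ℤ.+<+ (ℕ.s≤s ℕ.z≤n))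

    InConv⇔FacetIneqs : ∀ z → InConv (simplexVerts r x) z ⇔ FacetIneqs z
    InConv⇔FacetIneqs z = begin
      InConv (simplexVerts r x) z
        ∼⟨ mk⇔ (InConv-resp-≗ {z = z} verts≗) (InConv-resp-≗ {z = z} (λ i → sym ∘ verts≗ i)) ⟩
      InConv (Δ-vertices (qvec r x)) z
        ∼⟨ InConv-Δ⇔InΔ (qvec r x) z (ℤP.<⇒≤ ∘ q>0) ⟩
      InΔ (qvec r x) z
        ∼⟨ mk⇔ (Product.map₂ λ h k → Equivalence.to (rescale k) (h k))
                                               (Product.map₂ λ h k → Equivalence.from (rescale k) (h k)) ⟩
      FacetIneqs z ∎
      where
      open EquationalReasoning
      verts≗ : ∀ i → simplexVerts r x i ≗ Δ-vertices (qvec r x) i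
      verts≗ Fin.zero    k = refl
      verts≗ (Fin.suc i) k = refl
      rescale : ∀ k → _ ⇔ _
      rescale k = 0≤N*z+m*q⇔0≤c*z+m (facetWeight k) (qvec r x k) (z k) (slack z) (q>0 k) (trans (c*q≡N k) (sym 1+Σq≡N))

    A′Point⇒FacetIneqs : ∀ z → A′Point r x z → FacetIneqs z
    A′Point⇒FacetIneqs z (basis i z≗eᵢ) = subst (+0 ≤_) (sym m≡0) (ℤ.+≤+ ℕ.z≤n) , facet
      where
      m≡0 : slack z ≡ +0
      m≡0 = cong (λ s → + 1 - s) (trans (sum-cong-≗ z≗eᵢ) (sum-e i))
      facet : ∀ k → +0 ≤ facetWeight k * z k + slack z
      facet k rewrite m≡0 | ℤP.+-identityʳ (facetWeight k * z k) | z≗eᵢ k =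
        ℤ-*-nonNeg (blockVec-elim x (+0 ≤_) (ℤ.+≤+ ℕ.z≤n) (ℤ.+≤+ ℕ.z≤n) k) (e-nonNeg i k)
    A′Point⇒FacetIneqs z (block {g} {p} shape z≗ℓ) = subst (+0 ≤_) (sym m≡m′) (ℤ.+≤+ ℕ.z≤n) , facet
      where
      m′ = 1 ℕ.+ (x ℕ.* g ℕ.+ r′ ℕ.* p)
      m≡m′ : slack z ≡ + m′
      m≡m′ = trans (cong (λ s → + 1 - s) (trans (sum-cong-≗ z≗ℓ) (sum-negBlock x r′ g p)))
                   (cong (λ a → + 1 + a) (ℤP.neg-involutive (+ (x ℕ.* g ℕ.+ r′ ℕ.* p))))
      facet : ∀ k → +0 ≤ facetWeight k * z k + slack z
      facet k rewrite m≡m′ | z≗ℓ k with toℕ k <ᵇ x | A′Block⇒bounds r′ x shape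
      ... | true  | bound , _ = 0≤c*-g+m (1 ℕ.+ r ℕ.* x) g m′ bound
      ... | false | _ , bound = 0≤c*-g+m r p m′ bound

    FacetIneqs⇒A′Point : ∀ z → FacetIneqs z → A′Point r x z
    FacetIneqs⇒A′Point z (m≥0 , facet) = classify ℤ.∣ slack z ∣ (sym (ℤP.0≤i⇒+∣i∣≡i m≥0))
      where
      lower : ∀ M → slack z ≡ + M → ∀ k → blockVec x (- + (M / (1 ℕ.+ r ℕ.* x))) (- + (M / r)) k ≤ z k
      lower M m≡M k with toℕ k <ᵇ x | facet k
      ... | true  | 0≤ = 0≤c*w+M⇒-[M/c]≤w (r ℕ.* x) M (z k) (subst (λ m → +0 ≤ + suc (r ℕ.* x) * z k + m) m≡M 0≤)
      ... | false | 0≤ = 0≤c*w+M⇒-[M/c]≤w r′ M (z k) (subst (λ m → +0 ≤ + r * z k + m) m≡M 0≤)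

      classify : ∀ M → slack z ≡ + M → A′Point r x z
      classify zero m≡0 with nonNeg∧sum≡1⇒basis z z≥0 (slack≡⇒sum≡ {z = z} m≡0)
        where
        z≥0 : ∀ k → +0 ≤ z k
        z≥0 k = subst (_≤ z k) (blockVec-elim x (_≡ +0) refl refl k) (lower 0 m≡0 k)
      ... | i , z≗eᵢ = basis i z≗eᵢ
      classify (suc M′) m≡M = block shape (λ k → sym (ℓ≗z k))
        where
        M = suc M′
        g = M / (1 ℕ.+ r ℕ.* x)
        p = M / r
        ℓ = blockVec x (- + g) (- + p)
        Σz≡-M′ : sum z ≡ - + M′
        Σz≡-M′ = trans (slack≡⇒sum≡ {z = z} m≡M) (trans (ℤP.m-n≡m⊖n 1 M) (ℤP.⊖-≤ (ℕ.s≤s ℕ.z≤n)))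
        Σℓ≡ : sum ℓ ≡ - + (x ℕ.* g ℕ.+ r′ ℕ.* p)
        Σℓ≡ = sum-negBlock x r′ g p
        M′≤ : M′ ℕ.≤ x ℕ.* g ℕ.+ r′ ℕ.* p
        M′≤ = ℤP.drop‿+≤+ (ℤP.neg-cancel-≤ (subst₂ _≤_ Σℓ≡ Σz≡-M′ (sum-mono-≤ (lower M m≡M))))
        profile = floor-profile r′ x (m≡m%n+[m/n]*n M r) (m%n<n M r) (m/n*n≤m M (1 ℕ.+ r ℕ.* x)) M′≤
        shape = proj₂ profile
        ℓ≗z : ℓ ≗ z
        ℓ≗z = ≤∧sum≥⇒≗ (lower M m≡M)
                (ℤP.≤-reflexive (trans Σz≡-M′ (trans (cong (-_ ∘ +_) (proj₁ profile)) (sym Σℓ≡))))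

    FacetIneqs⇔A′Point : ∀ z → FacetIneqs z ⇔ A′Point r x z
    FacetIneqs⇔A′Point z = mk⇔ (FacetIneqs⇒A′Point z) (A′Point⇒FacetIneqs z)

open LatticePoints
open import Data.Nat using (ℕ; zero; suc; _≤_)
open import Data.Product using (_×_; _,_)
open import Function using (_⇔_; Equivalence)
open import Function.Related.Propositional using (module EquationalReasoning)

theorem1p4 : (r x : ℕ) → 2 ≤ r → 1 ≤ x →
    (z : IVec (dim r x)) →
    (InConv (simplexVerts r x) z → z ∈V A′ r x) × (z ∈V A′ r x → InConv (simplexVerts r x) z)
theorem1p4 zero     _ () _ _
theorem1p4 (suc r′) x _  _ z = Equivalence.to Δ∩ℤᵈ⇔A′ , Equivalence.from Δ∩ℤᵈ⇔A′
  where
  open EquationalReasoning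
  Δ∩ℤᵈ⇔A′ : InConv (simplexVerts (suc r′) x) z ⇔ z ∈V A′ (suc r′) x
  Δ∩ℤᵈ⇔A′ = begin
    InConv (simplexVerts (suc r′) x) z  ∼⟨ InConv⇔FacetIneqs r′ x z ⟩
    FacetIneqs r′ x z                   ∼⟨ FacetIneqs⇔A′Point r′ x z ⟩
    A′Point (suc r′) x z                ∼⟨ A′Point⇔∈A′ (suc r′) x z ⟩
    z ∈V A′ (suc r′) x                  ∎
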